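{- Let $\mathsf{CS}$ be any constant specification for $\mathsf{LPC}^+$. The rule "from $\phi\Leftrightarrow\psi$ infer $t{:}\phi\Leftrightarrow t{:}\psi$" is not validity preserving in $\mathsf{LPC}^+_{\mathsf{CS}}$: there exist formulas $\phi,\psi$ and a term $t$ such that $\vDash_{\mathsf{LPC}^+_{\mathsf{CS}}}\phi\Leftrightarrow\psi$ but $\not\vDash_{\mathsf{LPC}^+_{\mathsf{CS}}} t{:}\phi\Leftrightarrow t{:}\psi$.
   Context: $\phi\Leftrightarrow\psi$ abbreviates $(\phi>\psi)\wedge(\psi>\phi)$. Language: countable sets $\mathsf{Const}$, $\mathsf{Var}$, $\mathsf{Prop}$; terms $t ::= c \mid x \mid t\cdot t \mid t+t \mid\ !t$; formulas $\phi ::= p \mid \neg\phi \mid \phi\wedge\phi \mid \phi\supset\phi \mid \phi>\phi \mid t{:}\phi$. Axiom schemes of $\mathsf{LPC}^+$: (A1) classical tautologies; (A2) $(\phi>(\psi\supset\chi))\supset((\phi>\psi)\supset(\phi>\chi))$; (A3) $\phi>\phi$; (A4) $(\phi>\psi)\supset(\phi\supset\psi)$; (A5) $(s{:}(\phi>\psi)\wedge t{:}\phi)>(s\cdot t){:}\psi$; (A6) $s{:}\phi>(s+t){:}\phi$; (A7) $t{:}\phi>(s+t){:}\phi$; (A8) $t{:}\phi>\phi$; (A9) $t{:}\phi>{!t}{:}t{:}\phi$. A constant specification $\mathsf{CS}$ is a set of formulas $c{:}\phi$, $c\in\mathsf{Const}$, $\phi$ an instance of (A1)–(A9). Relational model: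 $\mathcal M=(W,W_N,R_{Fm},R_{Tm},V)$ with $W$ nonempty, $\emptyset\ne W_N\subseteq W$; $R_\phi\subseteq W_N\times W_N$ for each formula $\phi$; $R_t\subseteq W\times W$ for each term $t$; $V$ maps each $w\in W_N$ to a subset of $\mathsf{Prop}$ and each $w\in W\setminus W_N$ to a set of formulas. $R_\phi(w)=\{v:wR_\phi v\}$, $R_t(w)=\{v:wR_tv\}$, $[\![\phi]\!]=\{w\in W:(\mathcal M,w)\vDash\phi\}$. Truth: for $w\in W\setminus W_N$, $(\mathcal M,w)\vDash\phi$ iff $\phi\in V(w)$; for $w\in W_N$: $p$ iff $p\in V(w)$; $\neg,\wedge,\supset$ classically; $\phi>\psi$ iff $R_\phi(w)\subseteq[\![\psi]\!]$; $t{:}\phi$ iff $R_t(w)\subseteq[\![\phi]\!]$. An $\mathsf{LPC}^+_{\mathsf{CS}}$-model satisfies for all $w\in W_N$: (1) $R_\phi(w)\subseteq[\![\phi]\!]$; (2) $w\in[\![\phi]\!]$ implies $w\in R_\phi(w)$; (3) $R_c(w)\subseteq[\![\phi]\!]$ for $c{:}\phi\in\mathsf{CS}$; (4) $R_{s+t}(w)\subseteq R_s(w)\cap R_t(w)$; (5) $R_{s\cdot t}(w)\subseteq\{v\in W:$ for all $\phi,\psi$, if $w\in[\![s{:}(\phi>\psi)\wedge t{:}\phi]\!]$ then $v\in[\![\psi]\!]\}$; (6) $wR_tw$ for all $t$; (7) for all $t$, $v,u\in W$: $wR_{!t}v$ and $vR_tu$ imply $wR_tu$. $\vDash_{\mathsf{LPC}^+_{\mathsf{CS}}}\phi$: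 $\phi$ true at every normal state of every $\mathsf{LPC}^+_{\mathsf{CS}}$-model. -}

module Defs where

open import Data.Nat using (ℕ)
open import Data.Bool using (Bool; true; false; not; _∧_; _∨_)
open import Data.Product using (_×_; Σ; ∃)
open import Data.Sum using (_⊎_; inj₁; inj₂)
open import Data.Empty using (⊥)
open import Relation.Binary.PropositionalEquality using (_≡_)
open import Level using (Level; suc; _⊔_) renaming (zero to lzero)

Const Var PropVar : Set
Const = ℕ
Var = ℕ
PropVar = ℕ

infixl 7 _·_
infixl 6 _⊕_
data Tm : Set where
  con : Const → Tm
  var : Var → Tm
  _·_ : Tm → Tm → Tm
  _⊕_ : Tm → Tm → Tm
  !_  : Tm → Tm

infixr 5 _∶_
infixr 4 _⋀_
infixr 3 _⊃_ _▷_
data Fm : Set where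
  atom : PropVar → Fm
  ¬ᶠ_  : Fm → Fm
  _⋀_  : Fm → Fm → Fm
  _⊃_  : Fm → Fm → Fm
  _▷_  : Fm → Fm → Fm
  _∶_  : Tm → Fm → Fm

_⇔_ : Fm → Fm → Fm
φ ⇔ ψ = (φ ▷ ψ) ⋀ (ψ ▷ φ)

-- Classical tautologies: formulas true under every Boolean valuation that
-- treats ¬, ∧, ⊃ truth-functionally and all other formulas as atoms.
evalB : (Fm → Bool) → Fm → Bool
evalB v (atom p) = v (atom p)
evalB v (¬ᶠ φ) = not (evalB v φ)
evalB v (φ ⋀ ψ) = evalB v φ ∧ evalB v ψ
evalB v (φ ⊃ ψ) = not (evalB v φ) ∨ evalB v ψ
evalB v (φ ▷ ψ) = v (φ ▷ ψ)
evalB v (t ∶ φ) = v (t ∶ φ)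

Tautology : Fm → Set
Tautology φ = (v : Fm → Bool) → evalB v φ ≡ true

data Axiom : Fm → Set where
  A1 : ∀ {φ} → Tautology φ → Axiom φ
  A2 : ∀ φ ψ χ → Axiom ((φ ▷ (ψ ⊃ χ)) ⊃ ((φ ▷ ψ) ⊃ (φ ▷ χ)))
  A3 : ∀ φ → Axiom (φ ▷ φ)
  A4 : ∀ φ ψ → Axiom ((φ ▷ ψ) ⊃ (φ ⊃ ψ))
  A5 : ∀ s t φ ψ → Axiom (((s ∶ (φ ▷ ψ)) ⋀ (t ∶ φ)) ▷ ((s · t) ∶ ψ))
  A6 : ∀ s t φ → Axiom ((s ∶ φ) ▷ ((s ⊕ t) ∶ φ))
  A7 : ∀ s t φ → Axiom ((t ∶ φ) ▷ ((s ⊕ t) ∶ φ))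
  A8 : ∀ t φ → Axiom ((t ∶ φ) ▷ φ)
  A9 : ∀ t φ → Axiom ((t ∶ φ) ▷ ((! t) ∶ (t ∶ φ)))

IsCS : (Fm → Set) → Set
IsCS CS = ∀ χ → CS χ → Σ Const λ c → Σ Fm λ φ → (χ ≡ (con c ∶ φ)) × Axiom φ

-- Relational model.  W = W_N ⊎ W_A (normal and non-normal states),
-- W_N nonempty (witness `pt`).
record Model : Set₁ where
  field
    N    : Set
    A    : Set
    pt   : N
    Rf   : Fm → N → N → Set
    Rt   : Tm → N ⊎ A → N ⊎ A → Set
    VN   : N → PropVar → Set
    VA   : A → Fm → Set

  W : Set
  W = N ⊎ A

  mutual
    satN : N → Fm → Set
    satN w (atom p) = VN w p
    satN w (¬ᶠ φ) = satN w φ → ⊥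
    satN w (φ ⋀ ψ) = satN w φ × satN w ψ
    satN w (φ ⊃ ψ) = satN w φ → satN w ψ
    satN w (φ ▷ ψ) = ∀ v → Rf φ w v → satN v ψ
    satN w (t ∶ φ) = ∀ v → Rt t (inj₁ w) v → sat v φ

    sat : W → Fm → Set
    sat (inj₁ w) φ = satN w φ
    sat (inj₂ a) φ = VA a φ



record IsLPCModel (CS : Fm → Set) (M : Model) : Set where
  open Model M
  field
    c1 : ∀ w φ v → Rf φ w v → satN v φ
    c2 : ∀ w φ → satN w φ → Rf φ w w
    c3 : ∀ w c φ → CS (con c ∶ φ) → ∀ v → Rt (con c) (inj₁ w) v → sat v φ
    c4 : ∀ w s t v → Rt (s ⊕ t) (inj₁ w) v → Rt s (inj₁ w) v × Rt t (inj₁ w) v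
    c5 : ∀ w s t v → Rt (s · t) (inj₁ w) v →
           ∀ φ ψ → satN w ((s ∶ (φ ▷ ψ)) ⋀ (t ∶ φ)) → sat v ψ
    c6 : ∀ w t → Rt t (inj₁ w) (inj₁ w)
    c7 : ∀ w t v u → Rt (! t) (inj₁ w) v → Rt t v u → Rt t (inj₁ w) u

Valid : (Fm → Set) → Fm → Set₁
Valid CS φ = (M : Model) → IsLPCModel CS M → (w : Model.N M) → Model.satN M w φ

-- A countermodel with one normal state ● and one non-normal state ○ whose valuation contains
-- exactly the atoms. Every justification reaches ●, and the variable x₀ additionally reaches ○.
-- Then x₀ : p holds at ● while x₀ : (p ∧ p) fails there, since p ∧ p ∉ V(○), although p ⇔ (p ∧ p)
-- is valid. The model is an LPC⁺_CS-model for every CS because the constants only reach ●,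
-- where all axioms hold: satisfaction at ● is a Boolean evaluation, so tautologies hold, and the
-- other axiom schemes are sound in any LPC⁺-model whose !-successors are normal.
module Submission where

open import Defs
open import Data.Bool using (Bool; true; false; not; _∧_; _∨_; T)
open import Data.Bool.Properties using (T-∧; T-≡)
open import Data.Empty using (⊥; ⊥-elim)
open import Data.Product using (Σ; _×_; _,_; proj₁; proj₂)
open import Data.Sum using (_⊎_; inj₁; inj₂)
open import Data.Unit using (⊤; tt)
open import Function.Bundles using (Equivalence)
open import Relation.Binary.PropositionalEquality using (_≡_; refl; cong; cong₂; sym; trans)
open import Relation.Nullary using (¬_)

⋀-idem-valid : ∀ CS φ → Valid CS (φ ⇔ (φ ⋀ φ))
⋀-idem-valid CS φ M m w = (λ v r → let v⊨φ = c1 w φ v r in v⊨φ , v⊨φ)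
                        , (λ v r → proj₁ (c1 w (φ ⋀ φ) v r))
  where open IsLPCModel m

module _ {CS : Fm → Set} {M : Model} (m : IsLPCModel CS M) where
  open Model M
  open IsLPCModel m

  axiom-true : (∀ w {φ} → Tautology φ → satN w φ) →
               (∀ w t a → ¬ Rt (! t) (inj₁ w) (inj₂ a)) →
               ∀ w {φ} → Axiom φ → satN w φ
  axiom-true taut _ w (A1 {φ} φ-taut) = taut w {φ} φ-taut
  axiom-true _ _ w (A2 φ ψ χ) φ>ψ⊃χ φ>ψ v r = φ>ψ⊃χ v r (φ>ψ v r)
  axiom-true _ _ w (A3 φ) v r = c1 w φ v r
  axiom-true _ _ w (A4 φ ψ) φ>ψ w⊨φ = φ>ψ w (c2 w φ w⊨φ)
  axiom-true _ _ w (A5 s t φ ψ) v r u q = c5 v s t u q φ ψ (c1 w _ v r)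
  axiom-true _ _ w (A6 s t φ) v r u q = c1 w _ v r u (proj₁ (c4 v s t u q))
  axiom-true _ _ w (A7 s t φ) v r u q = c1 w _ v r u (proj₂ (c4 v s t u q))
  axiom-true _ _ w (A8 t φ) v r = c1 w _ v r (inj₁ v) (c6 v t)
  axiom-true _ _ w (A9 t φ) v r (inj₁ u) q x e = c1 w _ v r x (c7 v t (inj₁ u) x q e)
  axiom-true _ !-normal w (A9 t φ) v r (inj₂ a) q = ⊥-elim (!-normal v t a q)

T-not-intro : ∀ a → ¬ T a → T (not a)
T-not-intro true ¬a = ¬a tt
T-not-intro false _ = tt

T-not-elim : ∀ a → T (not a) → ¬ T a
T-not-elim false _ ()

T-⇒-intro : ∀ a {b} → (T a → T b) → T (not a ∨ b)
T-⇒-intro true a⇒b = a⇒b tt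
T-⇒-intro false _ = tt

T-⇒-elim : ∀ a {b} → T (not a ∨ b) → T a → T b
T-⇒-elim true b _ = b

module CounterModel where

  isVar₀ : Tm → Bool
  isVar₀ (var 0) = true
  isVar₀ _ = false

  isAtom : Fm → Bool
  isAtom (atom _) = true
  isAtom _ = false

  truth : Fm → Bool
  truth (atom p) = true
  truth (¬ᶠ φ) = not (truth φ)
  truth (φ ⋀ ψ) = truth φ ∧ truth ψ
  truth (φ ⊃ ψ) = not (truth φ) ∨ truth ψ
  truth (φ ▷ ψ) = not (truth φ) ∨ truth ψ
  truth (t ∶ φ) = truth φ ∧ (not (isVar₀ t) ∨ isAtom φ)

  pattern ● = inj₁ tt
  pattern ○ = inj₂ tt

  Reach : Tm → ⊤ ⊎ ⊤ → ⊤ ⊎ ⊤ → Set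
  Reach t ● ● = ⊤
  Reach t ● ○ = T (isVar₀ t)
  Reach t ○ _ = ⊥

  model : Model
  model = record
    { N = ⊤ ; A = ⊤ ; pt = tt
    ; Rf = λ φ _ _ → T (truth φ)
    ; Rt = Reach
    ; VN = λ _ _ → ⊤
    ; VA = λ _ φ → T (isAtom φ)
    }

  open Model model using (satN; sat)

  mutual
    satN→truth : ∀ φ → satN tt φ → T (truth φ)
    satN→truth (atom p) _ = tt
    satN→truth (¬ᶠ φ) ¬φ = T-not-intro (truth φ) λ φ-true → ¬φ (truth→satN φ φ-true)
    satN→truth (φ ⋀ ψ) (φ-holds , ψ-holds) =
      Equivalence.from T-∧ (satN→truth φ φ-holds , satN→truth ψ ψ-holds)
    satN→truth (φ ⊃ ψ) φ⊃ψ =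
      T-⇒-intro (truth φ) λ φ-true → satN→truth ψ (φ⊃ψ (truth→satN φ φ-true))
    satN→truth (φ ▷ ψ) φ>ψ = T-⇒-intro (truth φ) λ φ-true → satN→truth ψ (φ>ψ tt φ-true)
    satN→truth (t ∶ φ) t∶φ =
      Equivalence.from T-∧ (satN→truth φ (t∶φ ● tt) , T-⇒-intro (isVar₀ t) (t∶φ ○))

    truth→satN : ∀ φ → T (truth φ) → satN tt φ
    truth→satN (atom p) _ = tt
    truth→satN (¬ᶠ φ) ¬φ-true φ-holds = T-not-elim (truth φ) ¬φ-true (satN→truth φ φ-holds)
    truth→satN (φ ⋀ ψ) φ∧ψ-true =
      truth→satN φ (proj₁ (Equivalence.to T-∧ φ∧ψ-true))
      , truth→satN ψ (proj₂ (Equivalence.to T-∧ φ∧ψ-true))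
    truth→satN (φ ⊃ ψ) φ⊃ψ-true φ-holds =
      truth→satN ψ (T-⇒-elim (truth φ) φ⊃ψ-true (satN→truth φ φ-holds))
    truth→satN (φ ▷ ψ) φ>ψ-true tt φ-true = truth→satN ψ (T-⇒-elim (truth φ) φ>ψ-true φ-true)
    truth→satN (t ∶ φ) t∶φ-true ● _ = truth→satN φ (proj₁ (Equivalence.to T-∧ t∶φ-true))
    truth→satN (t ∶ φ) t∶φ-true ○ =
      T-⇒-elim (isVar₀ t) (proj₂ (Equivalence.to (T-∧ {truth φ}) t∶φ-true))

  evalB-truth : ∀ φ → evalB truth φ ≡ truth φ
  evalB-truth (atom p) = refl
  evalB-truth (¬ᶠ φ) = cong not (evalB-truth φ)
  evalB-truth (φ ⋀ ψ) = cong₂ _∧_ (evalB-truth φ) (evalB-truth ψ)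
  evalB-truth (φ ⊃ ψ) = cong₂ (λ a b → not a ∨ b) (evalB-truth φ) (evalB-truth ψ)
  evalB-truth (φ ▷ ψ) = refl
  evalB-truth (t ∶ φ) = refl

  tautology-true : ∀ w {φ} → Tautology φ → satN w φ
  tautology-true tt {φ} taut =
    truth→satN φ (Equivalence.from T-≡ (trans (sym (evalB-truth φ)) (taut truth)))

  isLPCModel : ∀ CS → IsCS CS → IsLPCModel CS model
  isLPCModel CS isCS = record { IsLPCModel isLPCModel∅ hiding (c3) ; c3 = constants-sound }
    where
    isLPCModel∅ : IsLPCModel (λ _ → ⊥) model
    isLPCModel∅ = record
      { c1 = λ _ φ _ → truth→satN φ
      ; c2 = λ _ φ → satN→truth φ
      ; c3 = λ _ _ _ ()
      ; c4 = λ { _ _ _ ● _ → tt , tt }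
      ; c5 = λ { _ _ _ ● _ φ _ (s∶φ>ψ , t∶φ) → s∶φ>ψ ● tt tt (satN→truth φ (t∶φ ● tt)) }
      ; c6 = λ _ _ → tt
      ; c7 = λ { _ _ ● _ _ t-edge → t-edge }
      }

    constants-sound : ∀ w c φ → CS (con c ∶ φ) → ∀ v → Reach (con c) (inj₁ w) v → sat v φ
    constants-sound tt c φ c∶φ∈CS ● _ with isCS _ c∶φ∈CS
    ... | _ , _ , refl , φ-axiom = axiom-true isLPCModel∅ tautology-true (λ { _ _ _ () }) tt φ-axiom

  refutes : ∀ p → ¬ satN tt ((var 0 ∶ atom p) ▷ (var 0 ∶ (atom p ⋀ atom p)))
  refutes p x₀∶p>x₀∶p∧p = x₀∶p>x₀∶p∧p tt tt ○ tt

lemma4 : (CS : Fm → Set) → IsCS CS →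
    Σ Fm λ φ → Σ Fm λ ψ → Σ Tm λ t →
      Valid CS (φ ⇔ ψ) × ¬ Valid CS ((t ∶ φ) ⇔ (t ∶ ψ))
lemma4 CS isCS = p , (p ⋀ p) , var 0 , ⋀-idem-valid CS p , not-valid
  where
  open CounterModel
  p : Fm
  p = atom 0
  not-valid : ¬ Valid CS ((var 0 ∶ p) ⇔ (var 0 ∶ (p ⋀ p)))
  not-valid valid = refutes 0 (proj₁ (valid model (isLPCModel CS isCS) tt))
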